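{- Let $G$ be a strong tricentral $2$-tree with tail set $\{2,3\}$, and let $x$ and $y$ be the numbers of tail vertices of degree $3$ and of degree $2$, respectively. Then $x+2y\equiv 0\pmod 3$.
   Context: A $2$-tree is a graph obtained from the triangle $K_3$ by repeatedly adding a new vertex adjacent to both endpoints of an existing edge. For $r\in\{1,2,3\}$ and an integer $\Delta\ge 2$, a $2$-tree on $n$ vertices is $r$-central with maximum degree $\Delta$ if $\Delta$ is its maximum degree and exactly $r$ vertices have degree $\Delta$; these $r$ vertices form the core and the other $n-r$ vertices form the tail. It is strong if the core induces $K_r$. It has tail set $\{2,3\}$ if every tail vertex has degree $2$ or $3$. "Tricentral" means $3$-central. -}

module Defs where

open import Data.Nat using (ℕ; zero; suc; _+_; _≤_; _≟_)
open import Data.Bool using (Bool; true; false; _∨_; if_then_else_)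
open import Data.Fin using (Fin; zero; suc)
import Data.Fin as F
open import Data.List using (List; length; filter; allFin)
open import Data.Product using (Σ; ∃; _×_; _,_)
open import Data.Sum using (_⊎_)
open import Relation.Nullary using (¬_; does)
open import Relation.Binary.PropositionalEquality using (_≡_)
open import Function.Bundles using (_↔_; Inverse)

record Graph (n : ℕ) : Set where
  field
    adj       : Fin n → Fin n → Bool
    symmetric : ∀ i j → adj i j ≡ adj j i
    loopless  : ∀ i → adj i i ≡ false
open Graph public

K3adj : Fin 3 → Fin 3 → Bool
K3adj i j = if does (i F.≟ j) then false else true

-- Add a new vertex (labelled zero, old vertices shifted by suc)
-- adjacent exactly to u and v.
extendAdj : ∀ {n} → (Fin n → Fin n → Bool) → Fin n → Fin n → Fin (suc n) → Fin (suc n) → Bool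
extendAdj A u v zero zero = false
extendAdj A u v zero (suc j) = does (j F.≟ u) ∨ does (j F.≟ v)
extendAdj A u v (suc i) zero = does (i F.≟ u) ∨ does (i F.≟ v)
extendAdj A u v (suc i) (suc j) = A i j

data LabelledTwoTree : (n : ℕ) → (Fin n → Fin n → Bool) → Set where
  triangle : LabelledTwoTree 3 K3adj
  extend   : ∀ {n A} → LabelledTwoTree n A → (u v : Fin n) → A u v ≡ true →
             LabelledTwoTree (suc n) (extendAdj A u v)

IsTwoTree : ∀ {n} → Graph n → Set
IsTwoTree {n} G =
  Σ (Fin n → Fin n → Bool) λ A → LabelledTwoTree n A ×
  Σ (Fin n ↔ Fin n) λ σ → ∀ i j → adj G (Inverse.to σ i) (Inverse.to σ j) ≡ A i j

countV : ∀ {n} → (Fin n → Bool) → ℕ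
countV {n} p = length (filter (λ v → Data.Bool._≟_ (p v) true) (allFin n))
  where import Data.Bool

degree : ∀ {n} → Graph n → Fin n → ℕ
degree G v = countV (adj G v)

IsMaxDegree : ∀ {n} → Graph n → ℕ → Set
IsMaxDegree G Δ = (∀ v → degree G v ≤ Δ) × ∃ λ v → degree G v ≡ Δ

inCore : ∀ {n} → Graph n → ℕ → Fin n → Bool
inCore G Δ v = does (degree G v ≟ Δ)

IsCentral : ∀ {n} → ℕ → Graph n → ℕ → Set
IsCentral r G Δ = 2 ≤ Δ × IsMaxDegree G Δ × countV (inCore G Δ) ≡ r

IsStrong : ∀ {n} → Graph n → ℕ → Set
IsStrong G Δ = ∀ u v → inCore G Δ u ≡ true → inCore G Δ v ≡ true → ¬ (u ≡ v) → adj G u v ≡ true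

HasTailSet23 : ∀ {n} → Graph n → ℕ → Set
HasTailSet23 G Δ = ∀ v → inCore G Δ v ≡ false → degree G v ≡ 2 ⊎ degree G v ≡ 3

tailCount : ∀ {n} → Graph n → ℕ → ℕ → ℕ
tailCount G Δ d = countV (λ v → if inCore G Δ v then false else does (degree G v ≟ d))

{-# OPTIONS --safe #-}
module Submission where

-- A 2-tree on n vertices has degree sum 4n − 6: the triangle contributes 6 and every
-- added vertex 4. For a tricentral 2-tree with x tail vertices of degree 3 and y of
-- degree 2 this reads 3Δ + 3x + 2y + 6 = 4(3 + x + y), i.e. 3Δ = x + 2y + 6.

open import Defs
open import Data.Nat using (ℕ; _+_; _*_; _%_)
open import Relation.Binary.PropositionalEquality using (_≡_)

open import Data.Bool using (Bool; true; false; _∨_; if_then_else_)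
import Data.Bool as Bool
open import Data.Bool.Properties using (T-≡)
open import Data.Empty using (⊥-elim)
open import Data.Fin using (Fin; zero; suc)
import Data.Fin as Fin
open import Data.List using (length; filter; tabulate; []; _∷_)
import Data.Nat as ℕ
open import Data.Nat.DivMod using ([m+kn]%n≡m%n; m*n%n≡0)
open import Data.Nat.Properties using (+-cancelˡ-≡; *-suc; *-zeroʳ; *-identityʳ; ≡ᵇ⇒≡; +-identityʳ; +-*-semiring)
open import Data.Nat.Tactic.RingSolver using (solve)
open import Data.Product using (_,_)
open import Data.Sum using (_⊎_; inj₁; inj₂)
open import Function.Bundles using (_↔_; Inverse; Equivalence)
open import Relation.Binary.PropositionalEquality using (refl; sym; trans; cong; cong₂; module ≡-Reasoning)
open import Relation.Nullary using (¬_; does; yes; no)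

open import Algebra.Properties.Semiring.Sum +-*-semiring
  using (sum; sum-syntax; sum-cong-≗; sum-replicate-zero; ∑-distrib-+; *-distribˡ-sum; sum-permute)

indicator : Bool → ℕ
indicator true  = 1
indicator false = 0

∑-one : ∀ n → ∑[ i < n ] 1 ≡ n
∑-one ℕ.zero    = refl
∑-one (ℕ.suc n) = cong ℕ.suc (∑-one n)

∑-indicator-≟ : ∀ {n} (u : Fin n) → ∑[ j < n ] indicator (does (j Fin.≟ u)) ≡ 1
∑-indicator-≟ {ℕ.suc n} zero    = cong ℕ.suc (sum-replicate-zero n)
∑-indicator-≟ {ℕ.suc n} (suc u) = ∑-indicator-≟ u

∑-indicator-pair : ∀ {n} {u v : Fin n} → ¬ u ≡ v →
                   ∑[ j < n ] indicator (does (j Fin.≟ u) ∨ does (j Fin.≟ v)) ≡ 2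
∑-indicator-pair {n} {u} {v} u≢v = begin
  ∑[ j < n ] indicator (does (j Fin.≟ u) ∨ does (j Fin.≟ v)) ≡⟨ sum-cong-≗ indicator-∨ ⟩
  ∑[ j < n ] (δ u j + δ v j)                                 ≡⟨ ∑-distrib-+ (δ u) (δ v) ⟩
  ∑[ j < n ] δ u j + ∑[ j < n ] δ v j                        ≡⟨ cong₂ _+_ (∑-indicator-≟ u) (∑-indicator-≟ v) ⟩
  2                                                          ∎
  where
  open ≡-Reasoning
  δ : Fin n → Fin n → ℕ
  δ w j = indicator (does (j Fin.≟ w))
  indicator-∨ : ∀ j → indicator (does (j Fin.≟ u) ∨ does (j Fin.≟ v)) ≡ δ u j + δ v j
  indicator-∨ j with j Fin.≟ u | j Fin.≟ v
  ... | yes refl | yes refl = ⊥-elim (u≢v refl)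
  ... | yes _    | no _     = refl
  ... | no _     | yes _    = refl
  ... | no _     | no _     = refl

countV≡∑ : ∀ {n} (p : Fin n → Bool) → countV p ≡ ∑[ i < n ] indicator (p i)
countV≡∑ p = length-filter-tabulate (λ i → i)
  where
  length-filter-tabulate : ∀ {m} (f : Fin m → _) →
    length (filter (λ v → p v Bool.≟ true) (tabulate f)) ≡ ∑[ i < m ] indicator (p (f i))
  length-filter-tabulate {ℕ.zero}  f = refl
  length-filter-tabulate {ℕ.suc m} f with p (f zero)
  ... | true  = cong ℕ.suc (length-filter-tabulate (λ i → f (suc i)))
  ... | false = length-filter-tabulate (λ i → f (suc i))

degreeᴬ : ∀ {n} → (Fin n → Fin n → Bool) → Fin n → ℕ
degreeᴬ {n} A i = ∑[ j < n ] indicator (A i j)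

labelledTwoTree-loopless : ∀ {n A} → LabelledTwoTree n A → ∀ i → A i i ≡ false
labelledTwoTree-loopless triangle zero             = refl
labelledTwoTree-loopless triangle (suc zero)       = refl
labelledTwoTree-loopless triangle (suc (suc zero)) = refl
labelledTwoTree-loopless (extend t u v _) zero     = refl
labelledTwoTree-loopless (extend t u v _) (suc i)  = labelledTwoTree-loopless t i

∑-degreeᴬ-extend : ∀ {n} (A : Fin n → Fin n → Bool) {u v : Fin n} → ¬ u ≡ v →
                   ∑[ i < ℕ.suc n ] degreeᴬ (extendAdj A u v) i ≡ 4 + ∑[ i < n ] degreeᴬ A i
∑-degreeᴬ-extend {n} A {u} {v} u≢v = begin
  ∑[ i < ℕ.suc n ] degreeᴬ (extendAdj A u v) i      ≡⟨⟩
  ∑[ j < n ] uv j + ∑[ i < n ] (uv i + degreeᴬ A i) ≡⟨ cong (∑[ j < n ] uv j +_) (∑-distrib-+ uv (degreeᴬ A)) ⟩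
  ∑[ j < n ] uv j + (∑[ i < n ] uv i + ∑[ i < n ] degreeᴬ A i)
    ≡⟨ cong (λ d → d + (d + ∑[ i < n ] degreeᴬ A i)) (∑-indicator-pair u≢v) ⟩
  4 + ∑[ i < n ] degreeᴬ A i                         ∎
  where
  open ≡-Reasoning
  uv : Fin n → ℕ
  uv j = indicator (does (j Fin.≟ u) ∨ does (j Fin.≟ v))

∑-degreeᴬ-labelledTwoTree : ∀ {n A} → LabelledTwoTree n A → ∑[ i < n ] degreeᴬ A i + 6 ≡ 4 * n
∑-degreeᴬ-labelledTwoTree triangle = refl
∑-degreeᴬ-labelledTwoTree {ℕ.suc n} (extend {A = A} t u v uv∈A) = begin
  ∑[ i < ℕ.suc n ] degreeᴬ (extendAdj A u v) i + 6 ≡⟨ cong (_+ 6) (∑-degreeᴬ-extend A u≢v) ⟩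
  4 + (∑[ i < n ] degreeᴬ A i + 6)                 ≡⟨ cong (4 +_) (∑-degreeᴬ-labelledTwoTree t) ⟩
  4 + 4 * n                                        ≡⟨ *-suc 4 n ⟨
  4 * ℕ.suc n                                      ∎
  where
  open ≡-Reasoning
  u≢v : ¬ u ≡ v
  u≢v refl with trans (sym uv∈A) (labelledTwoTree-loopless t u)
  ... | ()

∑-degree-iso : ∀ {n} (G : Graph n) {A : Fin n → Fin n → Bool} (σ : Fin n ↔ Fin n) →
               (∀ i j → adj G (Inverse.to σ i) (Inverse.to σ j) ≡ A i j) →
               ∑[ v < n ] degree G v ≡ ∑[ i < n ] degreeᴬ A i
∑-degree-iso {n} G {A} σ iso = trans (sum-permute (degree G) σ) (sum-cong-≗ degree-σ)
  where
  open Inverse σ using (to)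
  degree-σ : ∀ i → degree G (to i) ≡ degreeᴬ A i
  degree-σ i = begin
    degree G (to i)                              ≡⟨ countV≡∑ (adj G (to i)) ⟩
    ∑[ j < n ] indicator (adj G (to i) j)        ≡⟨ sum-permute (λ j → indicator (adj G (to i) j)) σ ⟩
    ∑[ j < n ] indicator (adj G (to i) (to j))   ≡⟨ sum-cong-≗ (λ j → cong indicator (iso i j)) ⟩
    degreeᴬ A i                                  ∎
    where open ≡-Reasoning

∑-degree-twoTree : ∀ {n} (G : Graph n) → IsTwoTree G → ∑[ v < n ] degree G v + 6 ≡ 4 * n
∑-degree-twoTree G (A , t , σ , iso) =
  trans (cong (_+ 6) (∑-degree-iso G σ iso)) (∑-degreeᴬ-labelledTwoTree t)

∑-distrib-+₃ : ∀ {n} (f g h : Fin n → ℕ) →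
               ∑[ i < n ] (f i + (g i + h i)) ≡ ∑[ i < n ] f i + (∑[ i < n ] g i + ∑[ i < n ] h i)
∑-distrib-+₃ {n} f g h = trans (∑-distrib-+ f (λ i → g i + h i)) (cong (∑[ i < n ] f i +_) (∑-distrib-+ g h))

∑-linear₃ : ∀ {n} (a b c : ℕ) (f g h : Fin n → ℕ) →
            ∑[ i < n ] (a * f i + (b * g i + c * h i)) ≡ a * sum f + (b * sum g + c * sum h)
∑-linear₃ a b c f g h = trans (∑-distrib-+₃ (λ i → a * f i) (λ i → b * g i) (λ i → c * h i))
  (cong₂ _+_ (sym (*-distribˡ-sum a f)) (cong₂ _+_ (sym (*-distribˡ-sum b g)) (sym (*-distribˡ-sum c h))))

does-≟⇒≡ : ∀ {m k : ℕ} → does (m ℕ.≟ k) ≡ true → m ≡ k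
does-≟⇒≡ {m} {k} eq = ≡ᵇ⇒≡ m k (Equivalence.from T-≡ eq)

tail-degree : ∀ d → d ≡ 2 ⊎ d ≡ 3 → d ≡ 3 * indicator (does (d ℕ.≟ 3)) + 2 * indicator (does (d ℕ.≟ 2))
tail-degree _ (inj₁ refl) = refl
tail-degree _ (inj₂ refl) = refl

tail-exclusive : ∀ d → d ≡ 2 ⊎ d ≡ 3 → 1 ≡ indicator (does (d ℕ.≟ 3)) + indicator (does (d ℕ.≟ 2))
tail-exclusive _ (inj₁ refl) = refl
tail-exclusive _ (inj₂ refl) = refl

module _ {n} (G : Graph n) (Δ : ℕ) where

  inTail : ℕ → Fin n → Bool
  inTail d v = if inCore G Δ v then false else does (degree G v ℕ.≟ d)

  core : Fin n → ℕ
  core v = indicator (inCore G Δ v)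

  tail : ℕ → Fin n → ℕ
  tail d v = indicator (inTail d v)

  coreSize≡∑ : countV (inCore G Δ) ≡ sum core
  coreSize≡∑ = countV≡∑ (inCore G Δ)

  tailCount≡∑ : ∀ d → tailCount G Δ d ≡ sum (tail d)
  tailCount≡∑ d = countV≡∑ (inTail d)

  module _ (tail₂₃ : HasTailSet23 G Δ) where

    degree-split : ∀ v → degree G v ≡ Δ * core v + (3 * tail 3 v + 2 * tail 2 v)
    degree-split v with inCore G Δ v in eq
    ... | true  = trans (does-≟⇒≡ eq) (sym (trans (+-identityʳ (Δ * 1)) (*-identityʳ Δ)))
    ... | false = trans (tail-degree d (tail₂₃ v eq))
                        (cong (_+ (3 * indicator (does (d ℕ.≟ 3)) + 2 * indicator (does (d ℕ.≟ 2)))) (sym (*-zeroʳ Δ)))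
      where d = degree G v

    vertex-split : ∀ v → 1 ≡ core v + (tail 3 v + tail 2 v)
    vertex-split v with inCore G Δ v in eq
    ... | true  = refl
    ... | false = tail-exclusive _ (tail₂₃ v eq)

    ∑-degree-split : ∑[ v < n ] degree G v
                     ≡ Δ * countV (inCore G Δ) + (3 * tailCount G Δ 3 + 2 * tailCount G Δ 2)
    ∑-degree-split = begin
      ∑[ v < n ] degree G v                                   ≡⟨ sum-cong-≗ degree-split ⟩
      ∑[ v < n ] (Δ * core v + (3 * tail 3 v + 2 * tail 2 v)) ≡⟨ ∑-linear₃ Δ 3 2 core (tail 3) (tail 2) ⟩
      Δ * sum core + (3 * sum (tail 3) + 2 * sum (tail 2))
        ≡⟨ cong₂ (λ c t → Δ * c + t) coreSize≡∑
                 (cong₂ (λ x y → 3 * x + 2 * y) (tailCount≡∑ 3) (tailCount≡∑ 2)) ⟨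
      Δ * countV (inCore G Δ) + (3 * tailCount G Δ 3 + 2 * tailCount G Δ 2) ∎
      where open ≡-Reasoning

    vertexCount-split : n ≡ countV (inCore G Δ) + (tailCount G Δ 3 + tailCount G Δ 2)
    vertexCount-split = begin
      n                                           ≡⟨ ∑-one n ⟨
      ∑[ v < n ] 1                                ≡⟨ sum-cong-≗ vertex-split ⟩
      ∑[ v < n ] (core v + (tail 3 v + tail 2 v)) ≡⟨ ∑-distrib-+₃ core (tail 3) (tail 2) ⟩
      sum core + (sum (tail 3) + sum (tail 2))
        ≡⟨ cong₂ _+_ coreSize≡∑ (cong₂ _+_ (tailCount≡∑ 3) (tailCount≡∑ 2)) ⟨
      countV (inCore G Δ) + (tailCount G Δ 3 + tailCount G Δ 2) ∎
      where open ≡-Reasoning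

three-core-congruence : ∀ Δ x y → Δ * 3 + (3 * x + 2 * y) + 6 ≡ 4 * (3 + (x + y)) → (x + 2 * y) % 3 ≡ 0
three-core-congruence Δ x y degreeSum = begin
  (x + 2 * y) % 3         ≡⟨ [m+kn]%n≡m%n (x + 2 * y) 2 3 ⟨
  (x + 2 * y + 2 * 3) % 3 ≡⟨ cong (_% 3) 3Δ≡x+2y+6 ⟨
  (Δ * 3) % 3             ≡⟨ m*n%n≡0 Δ 3 ⟩
  0                       ∎
  where
  open ≡-Reasoning
  3Δ≡x+2y+6 : Δ * 3 ≡ x + 2 * y + 2 * 3
  3Δ≡x+2y+6 = +-cancelˡ-≡ (3 * x + 2 * y + 6) _ _ (begin
    3 * x + 2 * y + 6 + Δ * 3     ≡⟨ solve (x ∷ y ∷ Δ ∷ []) ⟩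
    Δ * 3 + (3 * x + 2 * y) + 6   ≡⟨ degreeSum ⟩
    4 * (3 + (x + y))             ≡⟨ solve (x ∷ y ∷ Δ ∷ []) ⟩
    3 * x + 2 * y + 6 + (x + 2 * y + 2 * 3) ∎)

proposition5p2 : ∀ {n} (G : Graph n) (Δ : ℕ) → IsTwoTree G → IsCentral 3 G Δ → IsStrong G Δ → HasTailSet23 G Δ →
    (tailCount G Δ 3 + 2 * tailCount G Δ 2) % 3 ≡ 0
proposition5p2 {n} G Δ twoTree (_ , _ , core≡3) _ tail₂₃ = three-core-congruence Δ x y (begin
  Δ * 3 + (3 * x + 2 * y) + 6                   ≡⟨ cong (λ r → Δ * r + (3 * x + 2 * y) + 6) core≡3 ⟨
  Δ * countV (inCore G Δ) + (3 * x + 2 * y) + 6 ≡⟨ cong (_+ 6) (∑-degree-split G Δ tail₂₃) ⟨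
  ∑[ v < n ] degree G v + 6                     ≡⟨ ∑-degree-twoTree G twoTree ⟩
  4 * n                                         ≡⟨ cong (4 *_) (vertexCount-split G Δ tail₂₃) ⟩
  4 * (countV (inCore G Δ) + (x + y))           ≡⟨ cong (λ r → 4 * (r + (x + y))) core≡3 ⟩
  4 * (3 + (x + y))                             ∎)
  where
  open ≡-Reasoning
  x y : ℕ
  x = tailCount G Δ 3
  y = tailCount G Δ 2
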